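{- Let $\pi\in S_n$, and let $m_1,\dots ,m_k$ be its left-to-right maxima (in order of appearance). For every $i=1,\dots,k$, let $m_i (m_i-1)\cdots (m_i-j_i)$ be the longest decreasing subsequence of $\pi$ made of consecutive values, starting with $m_i$ and lying entirely to the left of $m_{i+1}$ (for $i=k$, with no right bound). Then $\pi$ can be written as $\pi =m_1 A_1 \cdots m_k A_k$, where each $A_i$ is a shuffle of the sequence $(m_i-1)\cdots (m_i - j_i)$ with a sequence $P_i$ (i.e. $A_i$ contains both sequences as subsequences and no other elements), the $P_i$'s collecting all remaining elements of $\pi$. Moreover, the output of PSB on $\pi$ is $$P_1\, (m_1 - j_1)\cdots m_1\; P_2\, (m_2-j_2)\cdots m_2 \;\cdots\; P_k\, (m_k - j_k) \cdots m_k .$$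
   Context: A pop stack with bypass supports three operations: PUSH (insert the current input element on top of the pop stack), POP (send all elements of the pop stack to the output, from top to bottom), and BYPASS (send the current input element directly to the output). The algorithm PSB processes the input permutation $\pi_1\cdots\pi_n$ from left to right: if the pop stack $S$ is empty or $\pi_i$ equals (top of $S$)$-1$, PUSH; else if $\pi_i <$ (top of $S$)$-1$, BYPASS; otherwise POP and then PUSH. At the end, a final POP is performed. A left-to-right maximum of $\pi$ is an entry larger than all entries to its left. A shuffle of two sequences $\rho,\sigma$ of distinct integers is a sequence containing both $\rho$ and $\sigma$ as subsequences and no other elements. -}

module Defs where

open import Data.Nat using (ℕ; zero; suc; _∸_; _<_; _≟_; _<?_)
open import Data.List using (List; []; _∷_; _++_; map; upTo; reverse; concatMap)
open import Data.List.Relation.Binary.Permutation.Propositional using (_↭_)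
open import Data.List.Relation.Binary.Sublist.Propositional using (_⊆_)
open import Data.Product using (_×_)
open import Relation.Nullary using (¬_; yes; no)

IsPerm : ℕ → List ℕ → Set
IsPerm n π = π ↭ map suc (upTo n)

-- Algorithm PSB.  psbGo S input : output, where S is the pop stack
-- (head of the list = top of the stack).
psbGo : List ℕ → List ℕ → List ℕ
psbGo S [] = S
psbGo [] (x ∷ xs) = psbGo (x ∷ []) xs
psbGo (t ∷ S) (x ∷ xs) with suc x ≟ t
... | yes _ = psbGo (x ∷ t ∷ S) xs
... | no _ with suc x <? t
...   | yes _ = x ∷ psbGo (t ∷ S) xs
...   | no _ = (t ∷ S) ++ psbGo (x ∷ []) xs      -- otherwise POP then PUSH

psb : List ℕ → List ℕ
psb π = psbGo [] π

-- left-to-right maxima, in order of appearance (entries are ≥ 1)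
ltrMaxGo : ℕ → List ℕ → List ℕ
ltrMaxGo c [] = []
ltrMaxGo c (x ∷ xs) with c <? x
... | yes _ = x ∷ ltrMaxGo x xs
... | no _ = ltrMaxGo c xs

ltrMaxima : List ℕ → List ℕ
ltrMaxima π = ltrMaxGo 0 π

data Shuffle {A : Set} : List A → List A → List A → Set where
  sh-[] : Shuffle [] [] []
  sh-l  : ∀ {x xs ys zs} → Shuffle xs ys zs → Shuffle (x ∷ xs) ys (x ∷ zs)
  sh-r  : ∀ {y xs ys zs} → Shuffle xs ys zs → Shuffle xs (y ∷ ys) (y ∷ zs)

chain : ℕ → ℕ → List ℕ
chain m j = map (λ i → m ∸ suc i) (upTo j)

record Block : Set where
  constructor block
  field
    m : ℕ
    j : ℕ
    A : List ℕ
    P : List ℕ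
open Block public

-- the conditions of the block-wise property for a single block:
-- A is a shuffle of (m-1)…(m-j) with P, and m (m-1)…(m-j) is the longest
-- decreasing run of consecutive values starting at m, as subsequence of m A
-- (i.e. of π, starting at m, to the left of the next left-to-right maximum)
BlockOK : Block → Set
BlockOK b =
  Shuffle (chain (m b) (j b)) (P b) (A b) ×
  ¬ ((m b ∷ chain (m b) (suc (j b))) ⊆ (m b ∷ A b))

flatten : List Block → List ℕ
flatten = concatMap (λ b → m b ∷ A b)

psbFormula : List Block → List ℕ
psbFormula = concatMap (λ b → P b ++ reverse (m b ∷ chain (m b) (j b)))

-- Cut π at its left-to-right maxima into blocks m A.  Scanning A greedily for m - 1, m - 2, ...
-- finds the longest run of consecutive values below m; the other entries of A form P.  On such a
-- block PSB pushes exactly the run, each run element being the top of the stack minus one, and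
-- bypasses every entry of P: that entry lies below the current top (it is below m and differs from
-- the run elements) and is not the top minus one, for that value either occurs later in the run or
-- would extend it.  The next left-to-right maximum exceeds the whole stack, so the stack is popped
-- as (m - j) ... m just before that maximum is pushed.

module Submission where

open import Defs
open import Data.Nat using (ℕ; zero; suc; pred; _∸_; _<_; _≤_; _≟_; _<?_; z<s)
open import Data.Nat.Properties
  using ( ≤∧≢⇒<; ≮⇒≥; <⇒≤pred; <⇒≢; <-asym; m<n⇒m<1+n; ≤-<-trans; ≤-trans; ≤-refl; pred[n]≤n
        ; suc-injective)
open import Data.List using (List; []; _∷_; _++_; [_]; map; upTo; applyUpTo; reverse; _ʳ++_)
open import Data.List.Properties using (++-assoc; ++-identityʳ; ∷-injectiveʳ; map-upTo)
open import Data.List.Membership.Propositional using (_∈_; _∉_)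
open import Data.List.Membership.Propositional.Properties using (∈-++⁺ʳ)
open import Data.List.Relation.Unary.All as All using (All; []; _∷_)
open import Data.List.Relation.Unary.All.Properties
  using (++⁻ˡ; ++⁻ʳ; All¬⇒¬Any) renaming (map⁺ to All-map⁺)
open import Data.List.Relation.Unary.Any using (here; there)
open import Data.List.Relation.Unary.AllPairs using ([]; _∷_)
open import Data.List.Relation.Unary.Unique.Propositional using (Unique)
open import Data.List.Relation.Unary.Unique.Propositional.Properties using (map⁺; upTo⁺)
open import Data.List.Relation.Binary.Disjoint.Propositional using (Disjoint; contractₗ)
open import Data.List.Relation.Binary.Sublist.Propositional using (_⊆_; _∷_; _∷ʳ_; minimum)
open import Data.List.Relation.Binary.Sublist.Propositional.Properties using (∷⁻)
open import Data.List.Relation.Binary.Permutation.Propositional using (↭-sym; ↭⇒↭ₛ)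
open import Data.List.Relation.Binary.Permutation.Propositional.Properties using (All-resp-↭)
import Data.List.Relation.Binary.Permutation.Setoid.Properties as SetoidPerm
open import Data.Product using (_×_; _,_; ∃-syntax)
open import Function using (_∘_)
open import Relation.Nullary using (¬_; yes; no; contradiction)
open import Relation.Binary.PropositionalEquality
  using (_≡_; _≢_; refl; sym; trans; cong; subst; ≢-sym; setoid; module ≡-Reasoning)

shuffle-∈ˡ : ∀ {X : Set} {x : X} {xs ys zs} → Shuffle (x ∷ xs) ys zs → x ∈ zs
shuffle-∈ˡ (sh-l _) = here refl
shuffle-∈ˡ (sh-r s) = there (shuffle-∈ˡ s)

All-ʳ++⁺ : ∀ {X : Set} {P : X → Set} {xs ys} → All P xs → All P ys → All P (xs ʳ++ ys)
All-ʳ++⁺ []         pys = pys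
All-ʳ++⁺ (px ∷ pxs) pys = All-ʳ++⁺ pxs (px ∷ pys)

Unique-++⁻ : ∀ {X : Set} (xs : List X) {ys} → Unique (xs ++ ys) →
             Unique xs × Unique ys × Disjoint xs ys
Unique-++⁻ []       uniq = [] , uniq , λ { (() , _) }
Unique-++⁻ (x ∷ xs) {ys} (x∉ ∷ uniq) =
  let (uniq-xs , uniq-ys , xs#ys) = Unique-++⁻ xs uniq
      disjoint : Disjoint (x ∷ xs) ys
      disjoint = λ where
        (here refl  , x∈ys) → All.lookup (++⁻ʳ xs x∉) x∈ys refl
        (there v∈xs , v∈ys) → xs#ys (v∈xs , v∈ys)
  in ++⁻ˡ xs x∉ ∷ uniq-xs , uniq-ys , disjoint

countdown : ℕ → ℕ → List ℕ
countdown u zero    = []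
countdown u (suc r) = pred u ∷ countdown (pred u) r

chain≡countdown : ∀ u r → chain u r ≡ countdown u r
chain≡countdown u r = trans (map-upTo (λ i → u ∸ suc i) r) (applyUpTo-countdown u r)
  where
  applyUpTo-countdown : ∀ u r → applyUpTo (λ i → u ∸ suc i) r ≡ countdown u r
  applyUpTo-countdown u       zero    = refl
  applyUpTo-countdown zero    (suc r) = cong (0 ∷_) (applyUpTo-countdown 0 r)
  applyUpTo-countdown (suc u) (suc r) = cong (u ∷_) (applyUpTo-countdown u r)

countdown-≤ : ∀ u r → All (_≤ u) (countdown u r)
countdown-≤ u zero    = []
countdown-≤ u (suc r) =
  pred[n]≤n ∷ All.map (λ a≤u-1 → ≤-trans a≤u-1 pred[n]≤n) (countdown-≤ (pred u) r)

blockOK⁻ : ∀ {u j A P} → BlockOK (block u j A P) →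
           Shuffle (countdown u j) P A × ¬ (countdown u (suc j) ⊆ A)
blockOK⁻ {u} {j} {A} {P} (sh , maximal) =
  subst (λ c → Shuffle c P A) (chain≡countdown u j) sh ,
  λ sub → maximal (refl ∷ subst (_⊆ A) (sym (chain≡countdown u (suc j))) sub)

blockOK⁺ : ∀ {u j A P} → Shuffle (countdown u j) P A → ¬ (countdown u (suc j) ⊆ A) →
           BlockOK (block u j A P)
blockOK⁺ {u} {j} {A} {P} sh maximal =
  subst (λ c → Shuffle c P A) (sym (chain≡countdown u j)) sh ,
  λ sub → maximal (subst (_⊆ A) (chain≡countdown u (suc j)) (∷⁻ sub))

countdownLength : ℕ → List ℕ → ℕ
countdownLength u []      = 0
countdownLength u (a ∷ A) with a ≟ pred u
... | yes _ = suc (countdownLength (pred u) A)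
... | no _  = countdownLength u A

countdownRest : ℕ → List ℕ → List ℕ
countdownRest u []      = []
countdownRest u (a ∷ A) with a ≟ pred u
... | yes _ = countdownRest (pred u) A
... | no _  = a ∷ countdownRest u A

countdown-shuffle : ∀ u A → Shuffle (countdown u (countdownLength u A)) (countdownRest u A) A
countdown-shuffle u []      = sh-[]
countdown-shuffle u (a ∷ A) with a ≟ pred u
... | yes refl = sh-l (countdown-shuffle (pred u) A)
... | no _     = sh-r (countdown-shuffle u A)

countdown-maximal : ∀ u A → ¬ (countdown u (suc (countdownLength u A)) ⊆ A)
countdown-maximal u []      ()
countdown-maximal u (a ∷ A) with a ≟ pred u
... | yes refl = countdown-maximal (pred u) A ∘ ∷⁻
... | no a≢u-1 = λ where
  (_ ∷ʳ sub)   → countdown-maximal u A sub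
  (u-1≡a ∷ _) → a≢u-1 (sym u-1≡a)

greedyBlock : ℕ → List ℕ → Block
greedyBlock u A = block u (countdownLength u A) A (countdownRest u A)

greedyBlock-ok : ∀ u A → BlockOK (greedyBlock u A)
greedyBlock-ok u A = blockOK⁺ (countdown-shuffle u A) (countdown-maximal u A)

takeUpTo : ℕ → List ℕ → List ℕ
takeUpTo c []       = []
takeUpTo c (x ∷ xs) with c <? x
... | yes _ = []
... | no _  = x ∷ takeUpTo c xs

takeUpTo-[] : ∀ {c} xs → All (c <_) xs → takeUpTo c xs ≡ []
takeUpTo-[]     []       _         = refl
takeUpTo-[] {c} (x ∷ xs) (c<x ∷ _) with c <? x
... | yes _  = refl
... | no c≮x = contradiction c<x c≮x

blocksAbove : ℕ → List ℕ → List Block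
blocksAbove c []       = []
blocksAbove c (x ∷ xs) with c <? x
... | yes _ = greedyBlock x (takeUpTo x xs) ∷ blocksAbove x xs
... | no _  = blocksAbove c xs

blocksAbove-heads : ∀ c xs → map m (blocksAbove c xs) ≡ ltrMaxGo c xs
blocksAbove-heads c []       = refl
blocksAbove-heads c (x ∷ xs) with c <? x
... | yes _ = cong (x ∷_) (blocksAbove-heads x xs)
... | no _  = blocksAbove-heads c xs

blocksAbove-ok : ∀ c xs → All BlockOK (blocksAbove c xs)
blocksAbove-ok c []       = []
blocksAbove-ok c (x ∷ xs) with c <? x
... | yes _ = greedyBlock-ok x (takeUpTo x xs) ∷ blocksAbove-ok x xs
... | no _  = blocksAbove-ok c xs

takeUpTo++flatten : ∀ c xs → takeUpTo c xs ++ flatten (blocksAbove c xs) ≡ xs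
takeUpTo++flatten c []       = refl
takeUpTo++flatten c (x ∷ xs) with c <? x
... | yes _ = cong (x ∷_) (takeUpTo++flatten x xs)
... | no _  = cong (x ∷_) (takeUpTo++flatten c xs)

block-decomposition : ∀ π → All (0 <_) π →
                      ∃[ bs ] (map m bs ≡ ltrMaxima π × flatten bs ≡ π × All BlockOK bs)
block-decomposition π π>0 =
  blocksAbove 0 π ,
  blocksAbove-heads 0 π ,
  trans (cong (_++ flatten (blocksAbove 0 π)) (sym (takeUpTo-[] π π>0))) (takeUpTo++flatten 0 π) ,
  blocksAbove-ok 0 π

psbGo-push : ∀ {t S x xs} → suc x ≡ t → psbGo (t ∷ S) (x ∷ xs) ≡ psbGo (x ∷ t ∷ S) xs
psbGo-push {t} {x = x} e with suc x ≟ t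
... | yes _  = refl
... | no x≢t = contradiction e x≢t

psbGo-bypass : ∀ {t S x xs} → suc x < t → psbGo (t ∷ S) (x ∷ xs) ≡ x ∷ psbGo (t ∷ S) xs
psbGo-bypass {t} {x = x} x<t with suc x ≟ t
... | yes e = contradiction e (<⇒≢ x<t)
... | no _ with suc x <? t
...   | yes _  = refl
...   | no x≮t = contradiction x<t x≮t

psbGo-pop : ∀ {T x xs} → All (_< x) T → psbGo T (x ∷ xs) ≡ T ++ psbGo [ x ] xs
psbGo-pop {[]} [] = refl
psbGo-pop {t ∷ S} {x} (t<x ∷ _) with suc x ≟ t
... | yes e = contradiction (sym e) (<⇒≢ (m<n⇒m<1+n t<x))
... | no _ with suc x <? t
...   | yes x<t = contradiction x<t (<-asym (m<n⇒m<1+n t<x))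
...   | no _    = refl

-- p = u - 1 is impossible: for r > 0 that value occurs in A, and for r = 0 it would extend the run.
bypassable : ∀ u r {p P A} → Shuffle (countdown u r) P A → All (p ≢_) A →
             ¬ (countdown u (suc r) ⊆ p ∷ A) → suc p ≢ u
bypassable u zero    _ _   maximal refl = maximal (refl ∷ minimum _)
bypassable u (suc r) s p∉A _       refl = All.lookup p∉A (shuffle-∈ˡ s) refl

psbGo-shuffle : ∀ u r {P A} → Shuffle (countdown u r) P A → Unique A → All (_< u) A →
                ¬ (countdown u (suc r) ⊆ A) → ∀ S xs →
                psbGo (u ∷ S) (A ++ xs) ≡ P ++ psbGo (countdown u r ʳ++ u ∷ S) xs
psbGo-shuffle-bypass : ∀ u r {p P A} → Shuffle (countdown u r) P A → Unique (p ∷ A) →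
                       All (_< u) (p ∷ A) → ¬ (countdown u (suc r) ⊆ p ∷ A) → ∀ S xs →
                       psbGo (u ∷ S) (p ∷ A ++ xs) ≡ p ∷ P ++ psbGo (countdown u r ʳ++ u ∷ S) xs

psbGo-shuffle u zero sh-[] _ _ _ S xs = refl
psbGo-shuffle u zero (sh-r s) uniq A<u maximal S xs =
  psbGo-shuffle-bypass u zero s uniq A<u maximal S xs
psbGo-shuffle u (suc r) (sh-r s) uniq A<u maximal S xs =
  psbGo-shuffle-bypass u (suc r) s uniq A<u maximal S xs
psbGo-shuffle zero (suc r) (sh-l s) _ (() ∷ _) _ S xs
psbGo-shuffle (suc u) (suc r) (sh-l {zs = A} s) (u∉A ∷ uniq) (_ ∷ A<su) maximal S xs =
  trans (psbGo-push {x = u} {xs = A ++ xs} refl)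
        (psbGo-shuffle u r s uniq (All.zipWith below (u∉A , A<su)) (maximal ∘ (refl ∷_))
                       (suc u ∷ S) xs)
  where
  below : ∀ {a} → u ≢ a × a < suc u → a < u
  below (u≢a , a<su) = ≤∧≢⇒< (<⇒≤pred a<su) (≢-sym u≢a)

psbGo-shuffle-bypass u r s (p∉A ∷ uniq) (p<u ∷ A<u) maximal S xs =
  trans (psbGo-bypass (≤∧≢⇒< p<u (bypassable u r s p∉A maximal)))
        (cong (_ ∷_) (psbGo-shuffle u r s uniq A<u (maximal ∘ (_ ∷ʳ_)) S xs))

data CutAtMaxima (c : ℕ) : List Block → Set where
  []  : CutAtMaxima c []
  _∷_ : ∀ {b bs} → c < m b × Unique (A b) × All (_< m b) (A b) → CutAtMaxima (m b) bs →
        CutAtMaxima c (b ∷ bs)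

psbGo-flatten : ∀ {c} T bs → All (_≤ c) T → CutAtMaxima c bs → All BlockOK bs →
                psbGo T (flatten bs) ≡ T ++ psbFormula bs
psbGo-flatten T [] _ [] [] = sym (++-identityʳ T)
psbGo-flatten T (block u j A P ∷ bs) T≤c ((c<u , uniq , A<u) ∷ cut) (ok ∷ oks) =
  let (sh , maximal) = blockOK⁻ ok in begin
    psbGo T (u ∷ A ++ flatten bs)
  ≡⟨ psbGo-pop (All.map (λ t≤c → ≤-<-trans t≤c c<u) T≤c) ⟩
    T ++ psbGo [ u ] (A ++ flatten bs)
  ≡⟨ cong (T ++_) (psbGo-shuffle u j sh uniq A<u maximal [] (flatten bs)) ⟩
    T ++ P ++ psbGo (countdown u j ʳ++ [ u ]) (flatten bs)
  ≡⟨ cong (λ S → T ++ P ++ S) (psbGo-flatten (countdown u j ʳ++ [ u ]) bs stack≤u cut oks) ⟩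
    T ++ P ++ (countdown u j ʳ++ [ u ]) ++ psbFormula bs
  -- reverse (u ∷ C) reduces to C ʳ++ [ u ]
  ≡⟨ cong (λ C → T ++ P ++ (C ʳ++ [ u ]) ++ psbFormula bs) (sym (chain≡countdown u j)) ⟩
    T ++ P ++ reverse (u ∷ chain u j) ++ psbFormula bs
  ≡⟨ cong (T ++_) (sym (++-assoc P (reverse (u ∷ chain u j)) (psbFormula bs))) ⟩
    T ++ psbFormula (block u j A P ∷ bs)
  ∎
  where
  open ≡-Reasoning
  stack≤u : All (_≤ u) (countdown u j ʳ++ [ u ])
  stack≤u = All-ʳ++⁺ (countdown-≤ u j) (≤-refl ∷ [])

heads-∈-flatten : ∀ bs {z} → z ∈ map m bs → z ∈ flatten bs
heads-∈-flatten (b ∷ bs) (here refl) = here refl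
heads-∈-flatten (b ∷ bs) (there z∈)  = there (∈-++⁺ʳ (A b) (heads-∈-flatten bs z∈))

ltrMaxGo-∈ : ∀ c xs {z} → z ∈ ltrMaxGo c xs → z ∈ xs
ltrMaxGo-∈ c (x ∷ xs) z∈ with c <? x | z∈
... | yes _ | here refl = here refl
... | yes _ | there z∈′ = there (ltrMaxGo-∈ x xs z∈′)
... | no _  | z∈′       = there (ltrMaxGo-∈ c xs z∈′)

ltrMaxGo-head : ∀ {c x xs L} → x ∉ xs → x ∷ L ≡ ltrMaxGo c (x ∷ xs) → c < x × L ≡ ltrMaxGo x xs
ltrMaxGo-head {c} {x} {xs} x∉xs e with c <? x
... | yes c<x = c<x , ∷-injectiveʳ e
... | no _    = contradiction (ltrMaxGo-∈ c xs (subst (x ∈_) e (here refl))) x∉xs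

ltrMaxGo-skip : ∀ {c} A {F L} → Disjoint A L → L ≡ ltrMaxGo c (A ++ F) →
                All (_≤ c) A × L ≡ ltrMaxGo c F
ltrMaxGo-skip     []      _   e = [] , e
ltrMaxGo-skip {c} (a ∷ A) A#L e with c <? a
... | yes _  = contradiction (here refl , subst (a ∈_) (sym e) (here refl)) A#L
... | no c≮a =
  let (A≤c , e′) = ltrMaxGo-skip A (contractₗ A#L) e in ≮⇒≥ c≮a ∷ A≤c , e′

cutAtMaxima : ∀ c bs → Unique (flatten bs) → map m bs ≡ ltrMaxGo c (flatten bs) → CutAtMaxima c bs
cutAtMaxima c [] _ _ = []
cutAtMaxima c (block u j A P ∷ bs) (u∉ ∷ uniq) heads =
  let (uniq-A , uniq-F , A#F) = Unique-++⁻ A uniq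
      (c<u , heads-AF) = ltrMaxGo-head (All¬⇒¬Any u∉) heads
      A#heads : Disjoint A (map m bs)
      A#heads = λ (a∈A , a∈L) → A#F (a∈A , heads-∈-flatten bs a∈L)
      (A≤u , heads-F) = ltrMaxGo-skip A A#heads heads-AF
  in (c<u , uniq-A , All.zipWith below (A≤u , ++⁻ˡ A u∉)) ∷ cutAtMaxima u bs uniq-F heads-F
  where
  below : ∀ {a} → a ≤ u × u ≢ a → a < u
  below (a≤u , u≢a) = ≤∧≢⇒< a≤u (≢-sym u≢a)

psb-formula : ∀ π → Unique π → ∀ bs → map m bs ≡ ltrMaxima π → flatten bs ≡ π → All BlockOK bs →
              psb π ≡ psbFormula bs
psb-formula _ uniq bs heads refl oks = psbGo-flatten [] bs [] (cutAtMaxima 0 bs uniq heads) oks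

mainTheorem7 : (n : ℕ) (π : List ℕ) → IsPerm n π →
    (∃[ bs ] (map m bs ≡ ltrMaxima π × flatten bs ≡ π × All BlockOK bs))
    × (∀ (bs : List Block) → map m bs ≡ ltrMaxima π → flatten bs ≡ π →
         All BlockOK bs → psb π ≡ psbFormula bs)
mainTheorem7 n π π↭ = block-decomposition π positive , psb-formula π unique
  where
  positive : All (0 <_) π
  positive = All-resp-↭ (↭-sym π↭) (All-map⁺ (All.universal (λ _ → z<s) (upTo n)))
  unique : Unique π
  unique = SetoidPerm.Unique-resp-↭ (setoid ℕ) (↭⇒↭ₛ (↭-sym π↭)) (map⁺ suc-injective (upTo⁺ n))
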